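{- Consider the algorithm which, on an instance with online chain precedence constraints consisting of $\omega$ chains, processes the front job of each chain $c$ with the fixed rate $(H_\omega\cdot i_c)^{ -1}$, where $i_c$ is the position of $c$ in a static weight order prediction $\hat\preceq_0$. This algorithm has competitive ratio at least $\Omega(\omega\cdot H_\omega)$ for minimizing the total weighted completion time on a single machine, even if $\hat\preceq_0$ equals the true weight order $\preceq_0$.
   Context: Problem (non-clairvoyant single-machine scheduling with online precedence constraints): jobs with processing requirements $p_j\ge0$ (unknown to the algorithm) and weights $w_j\ge0$; the precedence graph is a collection of $\omega$ disjoint chains; a job is revealed (with its weight) and may be processed only when its predecessor in its chain is completed. Time is discrete; rates $R_j^t\ge0$, $\sum_jR_j^t\le1$; $C_j$ is the first $t$ with $\sum_{t'\le t}R_j^{t'}\ge p_j$. Objective: minimize $\sum_jw_jC_j$ versus the offline optimum. $H_k=\sum_{i=1}^k1/i$. The true weight order $\preceq_0$ sorts the chains (equivalently their first jobs) by non-increasing total chain weight; a static weight order prediction $\hat\preceq_0$ is a predicted such order given at time $0$. -}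

module Defs where

open import Data.Nat as ℕ using (ℕ; zero; suc; _⊔_)
open import Data.Fin using (Fin; toℕ)
open import Data.List using (List; []; _∷_; length; lookup)
open import Data.Integer using (∣_∣)
open import Data.Rational
  using (ℚ; 0ℚ; 1ℚ; _+_; _*_; _≤_; _<_; ceiling)
  renaming (_/_ to _÷_)
open import Data.Product using (Σ; _×_; _,_; ∃)
open import Data.Fin.Permutation using (Permutation′; _⟨$⟩ʳ_)

ι : ℕ → ℚ
ι n = Data.Integer.+ n ÷ 1

Σℕ[<_] : (n : ℕ) → (ℕ → ℚ) → ℚ
Σℕ[< zero ] f = 0ℚ
Σℕ[< suc n ] f = Σℕ[< n ] f + f n

ΣFin : (n : ℕ) → (Fin n → ℚ) → ℚ
ΣFin zero f = 0ℚ
ΣFin (suc n) f = f Fin.zero + ΣFin n (λ i → f (Fin.suc i))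
  where import Data.Fin as Fin

H : ℕ → ℚ
H zero = 0ℚ
H (suc k) = H k + (Data.Integer.+ 1 ÷ suc k)

record Job : Set where
  constructor job
  field
    p : ℚ
    w : ℚ
    p≥0 : 0ℚ ≤ p
    w≥0 : 0ℚ ≤ w
open Job public

-- an instance: ω disjoint chains, each a list of jobs (head = first job)
Instance : ℕ → Set
Instance ω = Fin ω → List Job

chainWeight : List Job → ℚ
chainWeight [] = 0ℚ
chainWeight (j ∷ js) = w j + chainWeight js

totalWeight : (ω : ℕ) → Instance ω → ℚ
totalWeight ω I = ΣFin ω (λ c → chainWeight (I c))

-- A static weight order prediction: a bijection assigning each chain c its
-- position σ c ∈ {0,…,ω-1} (so i_c = σ c + 1).
-- It equals the true weight order ⪯₀ iff chains in earlier positions have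
-- total weight ≥ that of chains in later positions (ties broken arbitrarily).
IsTrueWeightOrder : (ω : ℕ) → Instance ω → Permutation′ ω → Set
IsTrueWeightOrder ω I σ =
  ∀ c d → toℕ (σ ⟨$⟩ʳ c) ℕ.< toℕ (σ ⟨$⟩ʳ d) →
    chainWeight (I d) ≤ chainWeight (I c)

-- Time steps t = 1, 2, 3, …  A job is revealed when
-- its predecessor completes (time 0 for the first job of a chain) and may
-- receive positive rate only in steps t > completion of its predecessor.
-- Its completion time is the first step t > (predecessor's completion)
-- with Σ_{t' ≤ t} R_j^{t'} ≥ p_j.

-- The algorithm: the front job of chain c is processed at the fixed rate
-- r = (H_ω · i)^{-1} with i = i_c.  A job revealed at time s with
-- requirement p then completes at s + max(1, ⌈p / r⌉) = s + max(1, ⌈p·H_ω·i⌉).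
algSteps : ℚ → ℚ → ℕ
algSteps p Hi = ∣ ceiling (p * Hi) ∣ ⊔ 1

algChainCost : ℚ → ℕ → List Job → ℚ
algChainCost Hi s [] = 0ℚ
algChainCost Hi s (j ∷ js) =
  let C = s ℕ.+ algSteps (p j) Hi in
  w j * ι C + algChainCost Hi C js

ALG : (ω : ℕ) → Instance ω → Permutation′ ω → ℚ
ALG ω I σ = ΣFin ω (λ c →
  algChainCost (H ω * ι (suc (toℕ (σ ⟨$⟩ʳ c)))) 0 (I c))

-- Arbitrary (offline) schedules, certified with completion times.
-- Jobs of chain c are indexed by Fin (length (I c)); index 0 is the head.

JobIdx : (ω : ℕ) → Instance ω → Set
JobIdx ω I = Σ (Fin ω) (λ c → Fin (length (I c)))

Rates : (ω : ℕ) → Instance ω → Set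
Rates ω I = (c : Fin ω) → Fin (length (I c)) → ℕ → ℚ

Times : (ω : ℕ) → Instance ω → Set
Times ω I = (c : Fin ω) → Fin (length (I c)) → ℕ

predTime : (n : ℕ) → (Fin n → ℕ) → Fin n → ℕ
predTime (suc n) C Fin.zero = 0
  where import Data.Fin as Fin
predTime (suc n) C (Fin.suc k) = C (Fin.inject₁ k)
  where import Data.Fin as Fin

-- R is a feasible schedule in which every job (c,k) is completed by time C c k
-- (i.e. C is an upper bound on the completion times under R).
FeasibleWithin : (ω : ℕ) (I : Instance ω) → Rates ω I → Times ω I → Set
FeasibleWithin ω I R C =
  (∀ c k t → 0ℚ ≤ R c k t)
  × (∀ t → ΣFin ω (λ c → ΣFin (length (I c)) (λ k → R c k t)) ≤ 1ℚ)
  × (∀ c k t → R c k t ≢0 → predTime (length (I c)) (C c) k ℕ.< t)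
  × (∀ c k → predTime (length (I c)) (C c) k ℕ.< C c k)
  × (∀ c k → p (lookup (I c) k) ≤ Σℕ[< suc (C c k) ] (λ t → R c k t))
  where
    _≢0 : ℚ → Set
    q ≢0 = ¬ (q ≡ 0ℚ)
      where open import Relation.Nullary using (¬_)
            open import Relation.Binary.PropositionalEquality using (_≡_)

cost : (ω : ℕ) (I : Instance ω) → Times ω I → ℚ
cost ω I C = ΣFin ω (λ c → ΣFin (length (I c)) (λ k →
  w (lookup (I c) k) * ι (C c k)))

-- The algorithm's rates are fixed in advance, so a chain predicted last is
-- served at rate 1/(ω H_ω) however idle the machine is.  Take one chain made of
-- a single job of length ω and ω − 1 chains made of a single job of length 0,
-- all of weight 1.  The chain weights tie, so the order placing the long chain
-- last is a true weight order; the algorithm then needs ⌈ω² H_ω⌉ steps for the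
-- long job, whereas finishing the empty jobs in step 1 and running the long job
-- at full rate afterwards costs at most 2ω.  Hence ALG ≥ ½ · ω H_ω · OPT.
module Submission where

open import Defs
open import Data.Nat as ℕ using (ℕ; zero; suc; _⊔_; _≥_; z≤n; s≤s)
import Data.Nat.Properties as ℕP
open import Data.Integer as ℤ using (+_; -[1+_]; ∣_∣)
import Data.Integer.Properties as ℤP
import Data.Integer.DivMod as ℤD
open import Data.Rational as ℚ
  using (ℚ; mkℚ; 0ℚ; 1ℚ; ½; _+_; _*_; _≤_; _<_; *≤*; ↥_; ↧_; -_; floor; ceiling)
import Data.Rational.Properties as ℚP
open import Data.Rational.Solver using (module +-*-Solver)
open import Data.Nat.Coprimality using (1-coprimeTo)
import Data.Nat.Coprimality as Coprime
open import Data.Fin using (Fin; zero; suc; toℕ)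
import Data.Fin.Properties as FinP
open import Data.Fin.Permutation using (Permutation′; _⟨$⟩ʳ_; reverse)
open import Data.List using ([]; _∷_; length; lookup)
open import Data.Product using (Σ; _×_; _,_)
open import Data.Empty using (⊥-elim)
open import Relation.Nullary using (¬_)
open import Relation.Binary.PropositionalEquality

ι≡mkℚ : ∀ n → ι n ≡ mkℚ (+ n) 0 (Coprime.sym (1-coprimeTo n))
ι≡mkℚ n = ℚP.normalize-coprime (Coprime.sym (1-coprimeTo n))

ι-suc : ∀ n → ι (suc n) ≡ ι n + 1ℚ
ι-suc n = begin
  ι (suc n)                    ≡⟨ cong ι (ℕP.+-comm 1 n) ⟩
  + (n ℕ.+ 1) ℚ./ 1             ≡⟨ cong (λ z → (z ℤ.+ + 1) ℚ./ 1) (sym (ℤP.*-identityʳ (+ n))) ⟩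
  (+ n ℤ.* + 1 ℤ.+ + 1) ℚ./ 1   ≡⟨ cong (_+ 1ℚ) (sym (ι≡mkℚ n)) ⟩
  ι n + 1ℚ                     ∎
  where open ≡-Reasoning

ι-mono-≤ : ∀ {m n} → m ℕ.≤ n → ι m ≤ ι n
ι-mono-≤ {m} {n} m≤n rewrite ι≡mkℚ m | ι≡mkℚ n =
  *≤* (subst₂ ℤ._≤_ (sym (ℤP.*-identityʳ (+ m))) (sym (ℤP.*-identityʳ (+ n))) (ℤ.+≤+ m≤n))

ι-nonNeg : ∀ n → 0ℚ ≤ ι n
ι-nonNeg n = ι-mono-≤ {0} {n} z≤n

0≤1 : 0ℚ ≤ 1ℚ
0≤1 = ι-nonNeg 1

H-nonNeg : ∀ k → 0ℚ ≤ H k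
H-nonNeg zero    = ℚP.≤-refl
H-nonNeg (suc k) = ℚP.+-mono-≤ (H-nonNeg k) (ℚP.nonNegative⁻¹ _ {{ℚP.normalize-nonNeg 1 (suc k)}})

i≤+∣i∣ : ∀ i → i ℤ.≤ + ∣ i ∣
i≤+∣i∣ (+ n)    = ℤP.≤-refl
i≤+∣i∣ -[1+ n ] = ℤ.-≤+

floor*↧≤↥ : ∀ q → floor q ℤ.* ↧ q ℤ.≤ ↥ q
floor*↧≤↥ q@record{} = begin
  floor q ℤ.* ↧ q                         ≤⟨ ℤP.i≤j+i _ (+ (↥ q ℤD.% ↧ q)) ⟩
  + (↥ q ℤD.% ↧ q) ℤ.+ floor q ℤ.* ↧ q    ≡⟨ ℤD.a≡a%n+[a/n]*n (↥ q) (↧ q) ⟨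
  ↥ q                                     ∎
  where open ℤP.≤-Reasoning

↥≤ceiling*↧ : ∀ q → ↥ q ℤ.≤ ceiling q ℤ.* ↧ q
↥≤ceiling*↧ q@record{} = begin
  ↥ q                              ≡⟨ ℤP.neg-involutive (↥ q) ⟨
  ℤ.- ℤ.- ↥ q                      ≡⟨ cong ℤ.-_ (ℚP.↥-neg q) ⟨
  ℤ.- ↥ (- q)                      ≤⟨ ℤP.neg-mono-≤ (floor*↧≤↥ (- q)) ⟩
  ℤ.- (floor (- q) ℤ.* ↧ (- q))    ≡⟨ cong (λ d → ℤ.- (floor (- q) ℤ.* d)) (ℚP.↧-neg q) ⟩
  ℤ.- (floor (- q) ℤ.* ↧ q)        ≡⟨ ℤP.neg-distribˡ-* (floor (- q)) (↧ q) ⟩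
  ceiling q ℤ.* ↧ q                ∎
  where open ℤP.≤-Reasoning

≤-ceiling⊔1 : ∀ q → q ≤ ι (∣ ceiling q ∣ ⊔ 1)
≤-ceiling⊔1 q@(mkℚ _ _ _) rewrite ι≡mkℚ (∣ ceiling q ∣ ⊔ 1) = *≤* (begin
  ↥ q ℤ.* + 1                      ≡⟨ ℤP.*-identityʳ (↥ q) ⟩
  ↥ q                              ≤⟨ ↥≤ceiling*↧ q ⟩
  ceiling q ℤ.* ↧ q                ≤⟨ ℤP.*-monoʳ-≤-nonNeg (↧ q) ceiling≤ ⟩
  + (∣ ceiling q ∣ ⊔ 1) ℤ.* ↧ q    ∎)
  where
  open ℤP.≤-Reasoning
  ceiling≤ : ceiling q ℤ.≤ + (∣ ceiling q ∣ ⊔ 1)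
  ceiling≤ = ℤP.≤-trans (i≤+∣i∣ (ceiling q)) (ℤ.+≤+ (ℕP.m≤m⊔n _ 1))

≤-algSteps : ∀ p Hi → p * Hi ≤ ι (algSteps p Hi)
≤-algSteps p Hi = ≤-ceiling⊔1 (p * Hi)

*-nonNeg : ∀ {p q} → 0ℚ ≤ p → 0ℚ ≤ q → 0ℚ ≤ p * q
*-nonNeg {p} {q} 0≤p 0≤q =
  ℚP.nonNegative⁻¹ _ {{ℚP.nonNeg*nonNeg⇒nonNeg p {{ℚ.nonNegative 0≤p}} q {{ℚ.nonNegative 0≤q}}}}

1*x+0≡x : ∀ x → 1ℚ * x + 0ℚ ≡ x
1*x+0≡x x = trans (ℚP.+-identityʳ _) (ℚP.*-identityˡ x)

ΣFin-nonNeg : ∀ n (f : Fin n → ℚ) → (∀ i → 0ℚ ≤ f i) → 0ℚ ≤ ΣFin n f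
ΣFin-nonNeg zero    f f≥0 = ℚP.≤-refl
ΣFin-nonNeg (suc n) f f≥0 = ℚP.+-mono-≤ (f≥0 zero) (ΣFin-nonNeg n _ (λ i → f≥0 (suc i)))

head≤ΣFin : ∀ n (f : Fin (suc n) → ℚ) → (∀ i → 0ℚ ≤ f i) → f zero ≤ ΣFin (suc n) f
head≤ΣFin n f f≥0 = begin
  f zero                              ≡⟨ ℚP.+-identityʳ (f zero) ⟨
  f zero + 0ℚ                         ≤⟨ ℚP.+-monoʳ-≤ (f zero) tail≥0 ⟩
  f zero + ΣFin n (λ i → f (suc i))   ∎
  where
  open ℚP.≤-Reasoning
  tail≥0 : 0ℚ ≤ ΣFin n (λ i → f (suc i))
  tail≥0 = ΣFin-nonNeg n _ (λ i → f≥0 (suc i))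

ΣFin-0 : ∀ n → ΣFin n (λ _ → 0ℚ) ≡ 0ℚ
ΣFin-0 zero    = refl
ΣFin-0 (suc n) rewrite ΣFin-0 n = refl

ΣFin-1 : ∀ n → ΣFin n (λ _ → 1ℚ) ≡ ι n
ΣFin-1 zero    = refl
ΣFin-1 (suc n) = begin
  1ℚ + ΣFin n (λ _ → 1ℚ)   ≡⟨ cong (λ x → 1ℚ + x) (ΣFin-1 n) ⟩
  1ℚ + ι n                 ≡⟨ ℚP.+-comm 1ℚ (ι n) ⟩
  ι n + 1ℚ                 ≡⟨ ι-suc n ⟨
  ι (suc n)                ∎
  where open ≡-Reasoning

algChainCost-nonNeg : ∀ Hi s js → 0ℚ ≤ algChainCost Hi s js
algChainCost-nonNeg Hi s []       = ℚP.≤-refl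
algChainCost-nonNeg Hi s (j ∷ js) =
  ℚP.+-mono-≤ (*-nonNeg (w≥0 j) (ι-nonNeg (s ℕ.+ algSteps (p j) Hi))) (algChainCost-nonNeg Hi _ js)

longJob : ℕ → Job
longJob n = job (ι n) 1ℚ (ι-nonNeg n) 0≤1

emptyJob : Job
emptyJob = job 0ℚ 1ℚ ℚP.≤-refl 0≤1

hardInstance : ∀ m → Instance (suc m)
hardInstance m zero    = longJob (suc m) ∷ []
hardInstance m (suc _) = emptyJob ∷ []

equalWeights⇒trueWeightOrder : ∀ m σ → IsTrueWeightOrder (suc m) (hardInstance m) σ
equalWeights⇒trueWeightOrder m σ c d _ = weight≤ c d
  where
  weight≤ : ∀ c d → chainWeight (hardInstance m d) ≤ chainWeight (hardInstance m c)
  weight≤ zero    zero    = ℚP.≤-refl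
  weight≤ zero    (suc _) = ℚP.≤-refl
  weight≤ (suc _) zero    = ℚP.≤-refl
  weight≤ (suc _) (suc _) = ℚP.≤-refl

totalWeight-pos : ∀ m → 0ℚ < totalWeight (suc m) (hardInstance m)
totalWeight-pos m = ℚP.<-≤-trans (ℚP.positive⁻¹ 1ℚ)
  (head≤ΣFin m _ (λ c → ℚP.≤-trans 0≤1 (chainWeight≥1 c)))
  where
  chainWeight≥1 : ∀ c → 1ℚ ≤ chainWeight (hardInstance m c)
  chainWeight≥1 zero    = ℚP.≤-refl
  chainWeight≥1 (suc _) = ℚP.≤-refl

fullRateFromStep1 : ℕ → ℚ
fullRateFromStep1 zero    = 0ℚ
fullRateFromStep1 (suc _) = 1ℚ

Σ-fullRateFromStep1 : ∀ n → Σℕ[< suc n ] fullRateFromStep1 ≡ ι n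
Σ-fullRateFromStep1 zero    = refl
Σ-fullRateFromStep1 (suc n) = trans (cong (_+ 1ℚ) (Σ-fullRateFromStep1 n)) (sym (ι-suc n))

offlineRates : ∀ m → Rates (suc m) (hardInstance m)
offlineRates m zero    _ t = fullRateFromStep1 t
offlineRates m (suc _) _ t = 0ℚ

offlineTimes : ∀ m → Times (suc m) (hardInstance m)
offlineTimes m zero    _ = suc m
offlineTimes m (suc _) _ = 1

offline-feasible : ∀ m → FeasibleWithin (suc m) (hardInstance m) (offlineRates m) (offlineTimes m)
offline-feasible m = nonNeg , capacity , precedence , afterPredecessor , finished
  where
  I : Instance (suc m)
  I = hardInstance m
  R : Rates (suc m) I
  R = offlineRates m
  C : Times (suc m) I
  C = offlineTimes m

  nonNeg : ∀ c k t → 0ℚ ≤ R c k t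
  nonNeg zero    zero zero    = ℚP.≤-refl
  nonNeg zero    zero (suc t) = 0≤1
  nonNeg (suc c) zero t       = ℚP.≤-refl

  capacity : ∀ t → ΣFin (suc m) (λ c → ΣFin (length (I c)) (λ k → R c k t)) ≤ 1ℚ
  capacity zero    rewrite ΣFin-0 m = 0≤1
  capacity (suc _) rewrite ΣFin-0 m = ℚP.≤-refl

  precedence : ∀ c k t → ¬ (R c k t ≡ 0ℚ) → predTime (length (I c)) (C c) k ℕ.< t
  precedence zero    zero zero    R≢0 = ⊥-elim (R≢0 refl)
  precedence zero    zero (suc t) _   = s≤s z≤n
  precedence (suc c) zero t       R≢0 = ⊥-elim (R≢0 refl)

  afterPredecessor : ∀ c k → predTime (length (I c)) (C c) k ℕ.< C c k
  afterPredecessor zero    zero = s≤s z≤n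
  afterPredecessor (suc c) zero = s≤s z≤n

  finished : ∀ c k → p (lookup (I c) k) ≤ Σℕ[< suc (C c k) ] (R c k)
  finished zero    zero = ℚP.≤-reflexive (sym (Σ-fullRateFromStep1 (suc m)))
  finished (suc c) zero = ℚP.≤-refl

offline-cost≤ : ∀ m → cost (suc m) (hardInstance m) (offlineTimes m) ≤ ι (suc m) + ι (suc m)
offline-cost≤ m = begin
  cost (suc m) (hardInstance m) (offlineTimes m)
    ≡⟨ cong₂ _+_ (1*x+0≡x (ι (suc m))) (ΣFin-1 m) ⟩
  ι (suc m) + ι m
    ≤⟨ ℚP.+-monoʳ-≤ (ι (suc m)) (ι-mono-≤ (ℕP.n≤1+n m)) ⟩
  ι (suc m) + ι (suc m)
    ∎
  where open ℚP.≤-Reasoning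

longJob-algChainCost : ∀ n Hi → ι n * Hi ≤ algChainCost Hi 0 (longJob n ∷ [])
longJob-algChainCost n Hi = begin
  ι n * Hi                                         ≤⟨ ≤-algSteps (ι n) Hi ⟩
  ι (algSteps (ι n) Hi)                            ≡⟨ 1*x+0≡x _ ⟨
  1ℚ * ι (algSteps (ι n) Hi) + 0ℚ                  ∎
  where open ℚP.≤-Reasoning

ALG-reverse-lower : ∀ m → let ω = suc m in
  ι ω * (H ω * ι ω) ≤ ALG ω (hardInstance m) reverse
ALG-reverse-lower m = begin
  ι ω * (H ω * ι ω)
    ≤⟨ longJob-algChainCost ω (H ω * ι ω) ⟩
  longChainCost (H ω * ι ω)
    ≡⟨ cong (λ i → longChainCost (H ω * ι (suc i))) (FinP.toℕ-fromℕ m) ⟨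
  longChainCost (Hi zero)
    ≤⟨ head≤ΣFin m _ (λ c → algChainCost-nonNeg (Hi c) 0 (hardInstance m c)) ⟩
  ALG ω (hardInstance m) reverse
    ∎
  where
  open ℚP.≤-Reasoning
  ω : ℕ
  ω = suc m
  Hi : Fin ω → ℚ
  Hi c = H ω * ι (suc (toℕ (reverse ⟨$⟩ʳ c)))
  longChainCost : ℚ → ℚ
  longChainCost r = algChainCost r 0 (longJob ω ∷ [])

ratio-bound : ∀ m → let ω = suc m in
  ½ * ι ω * H ω * cost ω (hardInstance m) (offlineTimes m) ≤ ALG ω (hardInstance m) reverse
ratio-bound m = begin
  ½ * x * h * cost (suc m) (hardInstance m) (offlineTimes m)
    ≤⟨ ℚP.*-monoˡ-≤-nonNeg (½ * x * h) {{½xh-nonNeg}} (offline-cost≤ m) ⟩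
  ½ * x * h * (x + x)
    ≡⟨ solve 2 (λ x h → con ½ :* x :* h :* (x :+ x) := x :* (h :* x)) refl x h ⟩
  x * (h * x)
    ≤⟨ ALG-reverse-lower m ⟩
  ALG (suc m) (hardInstance m) reverse
    ∎
  where
  open ℚP.≤-Reasoning
  open +-*-Solver
  x h : ℚ
  x = ι (suc m)
  h = H (suc m)
  ½xh-nonNeg : ℚ.NonNegative (½ * x * h)
  ½xh-nonNeg = ℚ.nonNegative
    (*-nonNeg (*-nonNeg (ℚP.nonNegative⁻¹ ½) (ι-nonNeg (suc m))) (H-nonNeg (suc m)))

lemma4 : Σ ℚ λ κ → 0ℚ < κ × Σ ℕ λ ω₀ → (ω : ℕ) → ω ≥ ω₀ →
           Σ (Instance ω) λ I → Σ (Permutation′ ω) λ σ →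
             IsTrueWeightOrder ω I σ × 0ℚ < totalWeight ω I ×
             Σ (Rates ω I) λ R → Σ (Times ω I) λ C →
               FeasibleWithin ω I R C ×
               κ * ι ω * H ω * cost ω I C ≤ ALG ω I σ
lemma4 = ½ , ℚP.positive⁻¹ ½ , 1 , λ where
  (suc m) _ → hardInstance m , reverse ,
              equalWeights⇒trueWeightOrder m reverse , totalWeight-pos m ,
              offlineRates m , offlineTimes m , offline-feasible m ,
              ratio-bound m
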